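{- If $D$ is a strong digraph of order at least three, then $\mathsf{d}_s^-(L(D))=\Lambda(D)$.
   Context: Digraphs are finite, loopless, without parallel arcs. A digraph is strong if for every ordered pair $u,v$ there is a directed $uv$-walk. The line digraph $L(D)$ has vertex set $A(D)$ and an arc from $(u,v)$ to $(w,z)$ iff $v=w$. For $E\subseteq A(D)$, $D[E]$ is the subdigraph with arc set $E$ and vertex set the end-vertices of arcs in $E$; a nonempty $E$ is a strong cover of $D$ if $D[E]$ is a spanning strong subdigraph of $D$. $\Lambda(D)$ is the maximum number of classes in a partition of $A(D)$ into strong covers. $S$ is in-dominating in $H$ if every vertex not in $S$ has an out-neighbor in $S$; strong in-dominating if moreover $H\langle S\rangle$ is strong; $\mathsf{d}_s^-(H)$ is the maximum number of classes of a partition of $V(H)$ into strong in-dominating sets. -}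

module Defs where

open import Data.Nat using (ℕ; _≤_)
open import Data.Fin using (Fin)
open import Data.Bool using (Bool; true; false)
open import Data.Product using (Σ; ∃; ∃-syntax; _×_; _,_; proj₁; proj₂)
open import Relation.Binary.PropositionalEquality using (_≡_)
open import Relation.Binary.Construct.Closure.ReflexiveTransitive using (Star)
open import Relation.Nullary using (¬_)
open import Data.Sum using (_⊎_)

record Digraph : Set where
  field
    n        : ℕ
    arc      : Fin n → Fin n → Bool
    loopless : ∀ v → arc v v ≡ false
open Digraph public

Arc : Digraph → Set
Arc D = Σ (Fin (n D) × Fin (n D)) λ p → arc D (proj₁ p) (proj₂ p) ≡ true

tail head : {D : Digraph} → Arc D → Fin (n D)
tail a = proj₁ (proj₁ a)
head a = proj₂ (proj₁ a)

record Graph : Set₁ where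
  field
    V   : Set
    Adj : V → V → Set
open Graph public

toGraph : Digraph → Graph
toGraph D = record { V = Fin (n D) ; Adj = λ u v → arc D u v ≡ true }

Strong : Graph → Set
Strong H = ∀ (u v : V H) → Star (Adj H) u v

L : Digraph → Graph
L D = record { V = Arc D ; Adj = λ a b → head {D} a ≡ tail {D} b }

SubArc : (D : Digraph) → (Arc D → Set) → Fin (n D) → Fin (n D) → Set
SubArc D E u v = Σ (arc D u v ≡ true) λ p → E ((u , v) , p)

EndVertex : (D : Digraph) → (Arc D → Set) → Fin (n D) → Set
EndVertex D E v = ∃[ a ] (E a × (tail {D} a ≡ v ⊎ head {D} a ≡ v))

StrongCover : (D : Digraph) → (Arc D → Set) → Set
StrongCover D E =
  (∃[ a ] E a) ×
  (∀ v → EndVertex D E v) ×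
  (∀ u v → Star (SubArc D E) u v)

-- A partition of a type X into exactly k (nonempty) classes, given by a
-- surjective class assignment c : X → Fin k; class i is c⁻¹(i).
IsPartition : (X : Set) (k : ℕ) → (X → Fin k) → Set
IsPartition X k c = ∀ (i : Fin k) → ∃[ x ] (c x ≡ i)

Class : {X : Set} {k : ℕ} → (X → Fin k) → Fin k → X → Set
Class c i x = c x ≡ i

HasStrongCoverPartition : Digraph → ℕ → Set
HasStrongCoverPartition D k =
  ∃[ c ] (IsPartition (Arc D) k c × (∀ i → StrongCover D (Class c i)))

InDominating : (H : Graph) → (V H → Set) → Set
InDominating H S = ∀ x → ¬ S x → ∃[ y ] (Adj H x y × S y)

InducedAdj : (H : Graph) → (V H → Set) → V H → V H → Set
InducedAdj H S x y = S x × S y × Adj H x y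

InducedStrong : (H : Graph) → (V H → Set) → Set
InducedStrong H S = ∀ x y → S x → S y → Star (InducedAdj H S) x y

StrongInDominating : (H : Graph) → (V H → Set) → Set
StrongInDominating H S = InDominating H S × InducedStrong H S

HasStrongInDomPartition : Graph → ℕ → Set
HasStrongInDomPartition H k =
  ∃[ c ] (IsPartition (V H) k c × (∀ i → StrongInDominating H (Class c i)))

IsMax : (ℕ → Set) → ℕ → Set
IsMax P m = P m × (∀ k → P k → k ≤ m)

ΛIs : Digraph → ℕ → Set
ΛIs D = IsMax (HasStrongCoverPartition D)

dsIs : Graph → ℕ → Set
dsIs H = IsMax (HasStrongInDomPartition H)

-- An arc set E of D is a vertex set of L(D), and walks of D[E] correspond to
-- walks of L(D)⟨E⟩ read arc by arc.  So E is a strong cover exactly when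
-- L(D)⟨E⟩ is strong and every arc outside E is followed by an arc of E.  For
-- the converse direction order ≥ 3 matters: for a ∈ E some arc of E meets a
-- vertex off a, so the walk of L(D)⟨E⟩ from a to it is nontrivial and an arc
-- of E leaves the head of a.  Hence both partition problems have the same
-- solutions, and their common maximum exists since partitions of the finitely
-- many arcs into strong covers are decidable by exhaustive search.
module Submission where

open import Defs
open import Data.Nat using (ℕ; _≤_)
open import Data.Product using (∃-syntax; _×_)

open import Axiom.UniquenessOfIdentityProofs using (module Decidable⇒UIP)
import Data.Bool as Bool
open import Data.Bool using (true)
open import Data.Fin using (Fin; zero; suc; _≟_; combine; fromℕ<)
open import Data.Fin.Properties using (any?; all?; combine-injective; injective⇒≤)
open import Data.List using (List; []; _∷_; allFin)
open import Data.List.Membership.Propositional using (_∈_)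
open import Data.List.Membership.Propositional.Properties using (∈-allFin)
open import Data.List.Relation.Unary.Any using (here; there)
open import Data.Nat using (suc; _*_; z≤n; s≤s)
open import Data.Nat.Properties using (≤-trans; m≤n⇒m<n∨m≡n)
open import Data.Product using (Σ; ∃; _,_; proj₁; proj₂)
open import Data.Sum using (_⊎_; inj₁; inj₂; [_,_])
open import Data.Vec using (Vec; []; _∷_; lookup; tabulate)
open import Data.Vec.Properties using (lookup∘tabulate)
open import Function using (_∘_; id; _⇔_; mk⇔; Injective; Equivalence)
open import Relation.Binary using (DecidableEquality)
open import Relation.Binary.Construct.Closure.ReflexiveTransitive using (Star; ε; _◅_; _◅◅_)
import Relation.Binary.Construct.Closure.ReflexiveTransitive as Star
open import Relation.Binary.PropositionalEquality
  using (_≡_; _≢_; refl; sym; trans; cong; cong₂; subst; _≗_; module ≡-Reasoning)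
open import Relation.Nullary using (¬_; Dec; yes; no; contradiction; Irrelevant)
open import Relation.Nullary.Decidable using (map′; _×-dec_; _⊎-dec_)
import Relation.Unary as U

open Decidable⇒UIP Bool._≟_ using (≡-irrelevant)

∃≢₂ : ∀ {m} → 3 ≤ m → (a b : Fin m) → ∃ λ z → z ≢ a × z ≢ b
∃≢₂ (s≤s (s≤s (s≤s _))) zero          zero          = suc zero , (λ ()) , (λ ())
∃≢₂ (s≤s (s≤s (s≤s _))) zero          (suc zero)    = suc (suc zero) , (λ ()) , (λ ())
∃≢₂ (s≤s (s≤s (s≤s _))) zero          (suc (suc _)) = suc zero , (λ ()) , (λ ())
∃≢₂ (s≤s (s≤s (s≤s _))) (suc zero)    zero          = suc (suc zero) , (λ ()) , (λ ())
∃≢₂ (s≤s (s≤s (s≤s _))) (suc zero)    (suc _)       = zero , (λ ()) , (λ ())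
∃≢₂ (s≤s (s≤s (s≤s _))) (suc (suc _)) zero          = suc zero , (λ ()) , (λ ())
∃≢₂ (s≤s (s≤s (s≤s _))) (suc (suc _)) (suc _)       = zero , (λ ()) , (λ ())

module _ {A : Set} {R : A → A → Set} where

  Star-first : ∀ {x y} → x ≢ y → Star R x y → ∃ (R x)
  Star-first x≢x ε       = contradiction refl x≢x
  Star-first _   (r ◅ _) = _ , r

  ◅-last : ∀ {x z y} → R x z → Star R z y → ∃ λ w → R w y
  ◅-last r ε        = _ , r
  ◅-last _ (s ◅ rs) = ◅-last s rs

  Star-last : ∀ {x y} → x ≢ y → Star R x y → ∃ λ w → R w y
  Star-last x≢x ε        = contradiction refl x≢x
  Star-last _   (r ◅ rs) = ◅-last r rs

-- Walks all of whose inner vertices lie in ws.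
data Via {A : Set} (R : A → A → Set) (ws : List A) : A → A → Set where
  stay : ∀ {u} → Via R ws u u
  step : ∀ {u v} → R u v → Via R ws u v
  join : ∀ {u w v} → w ∈ ws → Via R ws u w → Via R ws w v → Via R ws u v

module _ {A : Set} {R : A → A → Set} where

  Via⇒Star : ∀ {ws u v} → Via R ws u v → Star R u v
  Via⇒Star stay         = ε
  Via⇒Star (step r)     = r ◅ ε
  Via⇒Star (join _ p q) = Via⇒Star p ◅◅ Via⇒Star q

  Star⇒Via : ∀ {ws} → (∀ w → w ∈ ws) → ∀ {u v} → Star R u v → Via R ws u v
  Star⇒Via _     ε        = stay
  Star⇒Via all∈ (r ◅ rs) = join (all∈ _) (step r) (Star⇒Via all∈ rs)

  Via-[] : ∀ {u v} → Via R [] u v → u ≡ v ⊎ R u v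
  Via-[] stay       = inj₁ refl
  Via-[] (step r)   = inj₂ r
  Via-[] (join () _ _)

  Via-weaken : ∀ {w ws u v} → Via R ws u v → Via R (w ∷ ws) u v
  Via-weaken stay          = stay
  Via-weaken (step r)      = step r
  Via-weaken (join w∈ p q) = join (there w∈) (Via-weaken p) (Via-weaken q)

  Via-split : ∀ {w ws u v} → Via R (w ∷ ws) u v →
              Via R ws u v ⊎ (Via R ws u w × Via R ws w v)
  Via-split stay     = inj₁ stay
  Via-split (step r) = inj₁ (step r)
  Via-split (join (here refl) p q) =
    inj₂ ([ id , proj₁ ] (Via-split p) , [ id , proj₂ ] (Via-split q))
  Via-split (join (there w∈) p q) with Via-split p | Via-split q
  ... | inj₁ p′        | inj₁ q′        = inj₁ (join w∈ p′ q′)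
  ... | inj₁ p′        | inj₂ (q₁ , q₂) = inj₂ (join w∈ p′ q₁ , q₂)
  ... | inj₂ (p₁ , p₂) | inj₁ q′        = inj₂ (p₁ , join w∈ p₂ q′)
  ... | inj₂ (p₁ , _)  | inj₂ (_ , q₂)  = inj₂ (p₁ , q₂)

  Via-unsplit : ∀ {w ws u v} → Via R ws u v ⊎ (Via R ws u w × Via R ws w v) →
                Via R (w ∷ ws) u v
  Via-unsplit (inj₁ p)       = Via-weaken p
  Via-unsplit (inj₂ (p , q)) = join (here refl) (Via-weaken p) (Via-weaken q)

  module _ (_≟ᴬ_ : DecidableEquality A) (R? : ∀ u v → Dec (R u v)) where

    -- Floyd–Warshall: allow one more inner vertex at a time.
    Via? : ∀ ws u v → Dec (Via R ws u v)
    Via? []       u v = map′ [ (λ { refl → stay }) , step ] Via-[] ((u ≟ᴬ v) ⊎-dec R? u v)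
    Via? (w ∷ ws) u v =
      map′ Via-unsplit Via-split (Via? ws u v ⊎-dec (Via? ws u w ×-dec Via? ws w v))

    Star? : (ws : List A) → (∀ w → w ∈ ws) → ∀ u v → Dec (Star R u v)
    Star? ws all∈ u v = map′ Via⇒Star (Star⇒Via all∈) (Via? ws u v)

Searchable : Set → Set₁
Searchable A = ∀ {P : A → Set} → U.Decidable P → Dec (∃ P)

Fin-searchable : ∀ {m} → Searchable (Fin m)
Fin-searchable P? = any? P?

Vec-searchable : ∀ {A} → Searchable A → ∀ {m} → Searchable (Vec A m)
Vec-searchable _ {ℕ.zero} P? = map′ ([] ,_) (λ { ([] , p) → p }) (P? [])
Vec-searchable search {suc m} {P} P? =
  map′ (λ (x , xs , p) → x ∷ xs , p) (λ { (x ∷ xs , p) → x , xs , p })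
       (search {λ x → ∃ λ xs → P (x ∷ xs)} λ x → Vec-searchable search λ xs → P? (x ∷ xs))

Σ-dec : ∀ {B : Set} {P : B → Set} → Dec B → Irrelevant B → U.Decidable P → Dec (Σ B P)
Σ-dec {P = P} (yes b) irr P? = map′ (b ,_) (λ (c , p) → subst P (irr c b) p) (P? b)
Σ-dec         (no ¬b) _   _  = no (¬b ∘ proj₁)

∃?-by-decoding : ∀ {T A B : Set} → Searchable T → (decode : T → A → B) →
                 (∀ f → ∃ λ t → decode t ≗ f) →
                 ∀ {P : (A → B) → Set} → (∀ {f g} → f ≗ g → P f → P g) →
                 U.Decidable P → Dec (∃ P)
∃?-by-decoding search decode surj resp P? =
  map′ (λ (t , p) → decode t , p)
       (λ (f , p) → let (t , t≗f) = surj f in t , resp (sym ∘ t≗f) p)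
       (search λ t → P? (decode t))

module _ {P : ℕ → Set} (P? : U.Decidable P) where

  private
    ≤-pred-unless : ∀ {b j} → ¬ P (suc b) → P j → j ≤ suc b → j ≤ b
    ≤-pred-unless ¬pb pj j≤ with m≤n⇒m<n∨m≡n j≤
    ... | inj₁ (s≤s j≤b) = j≤b
    ... | inj₂ refl      = contradiction pj ¬pb

  max-≤ : ∀ b {k} → P k → k ≤ b → ∃ λ m → P m × (∀ {j} → P j → j ≤ b → j ≤ m)
  max-≤ ℕ.zero {ℕ.zero} pk _ = 0 , pk , λ _ j≤0 → j≤0
  max-≤ (suc b) pk k≤ with P? (suc b)
  ... | yes pb  = suc b , pb , λ _ j≤ → j≤
  ... | no  ¬pb =
    let (m , pm , max) = max-≤ b pk (≤-pred-unless ¬pb pk k≤)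
    in  m , pm , λ pj j≤ → max pj (≤-pred-unless ¬pb pj j≤)

  bounded⇒∃IsMax : ∀ {b} → (∀ {k} → P k → k ≤ b) → ∀ {k} → P k → ∃ (IsMax P)
  bounded⇒∃IsMax {b} bound pk =
    let (m , pm , max) = max-≤ b pk (bound pk) in m , pm , λ _ pj → max pj (bound pj)

IsMax-⇔ : ∀ {P Q : ℕ → Set} {m} → (∀ k → P k ⇔ Q k) → IsMax P m → IsMax Q m
IsMax-⇔ P⇔Q (pm , max) =
  Equivalence.to (P⇔Q _) pm , λ k qk → max k (Equivalence.from (P⇔Q k) qk)

partition-size-≤ : ∀ {X : Set} {k m} {c : X → Fin k} (code : X → Fin m) →
                   Injective _≡_ _≡_ code → IsPartition X k c → k ≤ m
partition-size-≤ {X = X} {k} {c = c} code code-inj part = injective⇒≤ {f = code ∘ rep} rep-inj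
  where
  rep : Fin k → X
  rep i = proj₁ (part i)
  rep-inj : Injective _≡_ _≡_ (code ∘ rep)
  rep-inj {i} {j} eq =
    trans (sym (proj₂ (part i))) (trans (cong c (code-inj eq)) (proj₂ (part j)))

module _ (D : Digraph) where

  Arc-≡ : {a b : Arc D} → proj₁ a ≡ proj₁ b → a ≡ b
  Arc-≡ {p , e} {.p , e′} refl = cong (p ,_) (≡-irrelevant e e′)

  arc-code : Arc D → Fin (n D * n D)
  arc-code a = combine (tail {D} a) (head {D} a)

  arc-code-injective : Injective _≡_ _≡_ arc-code
  arc-code-injective {a} eq =
    let (t≡ , h≡) = combine-injective (tail {D} a) (head {D} a) _ _ eq
    in  Arc-≡ (cong₂ _,_ t≡ h≡)

  SubArc? : ∀ {E : Arc D → Set} → U.Decidable E → ∀ u v → Dec (SubArc D E u v)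
  SubArc? E? u v = Σ-dec (arc D u v Bool.≟ true) ≡-irrelevant (λ p → E? ((u , v) , p))

  Arc-searchable : Searchable (Arc D)
  Arc-searchable P? =
    map′ (λ (u , v , p , q) → ((u , v) , p) , q) (λ (((u , v) , p) , q) → u , v , p , q)
         (any? λ u → any? λ v → SubArc? P? u v)

  StrongCover? : ∀ {E : Arc D → Set} → U.Decidable E → Dec (StrongCover D E)
  StrongCover? E? =
    Arc-searchable E? ×-dec
    all? (λ v → Arc-searchable λ a →
                  E? a ×-dec ((tail {D} a ≟ v) ⊎-dec (head {D} a ≟ v))) ×-dec
    all? (λ u → all? λ v → Star? _≟_ (SubArc? E?) (allFin _) ∈-allFin u v)

  StrongCover-mono : ∀ {E F : Arc D → Set} → E U.⊆ F → StrongCover D E → StrongCover D F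
  StrongCover-mono E⊆F ((a , Ea) , ends , walks) =
    (a , E⊆F Ea) ,
    (λ v → let (b , Eb , end) = ends v in b , E⊆F Eb , end) ,
    (λ u v → Star.map (λ (p , Ea) → p , E⊆F Ea) (walks u v))

  IsStrongCoverPartition : ∀ {k} → (Arc D → Fin k) → Set
  IsStrongCoverPartition {k} c = IsPartition (Arc D) k c × (∀ i → StrongCover D (Class c i))

  IsStrongCoverPartition? : ∀ {k} (c : Arc D → Fin k) → Dec (IsStrongCoverPartition c)
  IsStrongCoverPartition? c =
    all? (λ i → Arc-searchable λ a → c a ≟ i) ×-dec all? (λ i → StrongCover? λ a → c a ≟ i)

  IsStrongCoverPartition-≗ : ∀ {k} {c c′ : Arc D → Fin k} → c ≗ c′ →
                             IsStrongCoverPartition c → IsStrongCoverPartition c′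
  IsStrongCoverPartition-≗ c≗c′ (part , covers) =
    (λ i → let (a , ca≡i) = part i in a , trans (sym (c≗c′ a)) ca≡i) ,
    (λ i → StrongCover-mono (λ {a} ca≡i → trans (sym (c≗c′ a)) ca≡i) (covers i))

  arcTable : ∀ {B : Set} → Vec (Vec B (n D)) (n D) → Arc D → B
  arcTable t a = lookup (lookup t (tail {D} a)) (head {D} a)

  arcTable-surjective : ∀ {B : Set} → B → (f : Arc D → B) → ∃ λ t → arcTable t ≗ f
  arcTable-surjective {B} default f = tabulate (tabulate ∘ extend) , lookup-extend
    where
    extend : Fin (n D) → Fin (n D) → B
    extend u v with arc D u v Bool.≟ true
    ... | yes p = f ((u , v) , p)
    ... | no  _ = default

    extend-arc : ∀ a → extend (tail {D} a) (head {D} a) ≡ f a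
    extend-arc ((u , v) , p) with arc D u v Bool.≟ true
    ... | yes q  = cong (λ q → f ((u , v) , q)) (≡-irrelevant q p)
    ... | no  ¬p = contradiction p ¬p

    lookup-extend : ∀ a → arcTable (tabulate (tabulate ∘ extend)) a ≡ f a
    lookup-extend a = begin
      lookup (lookup (tabulate (tabulate ∘ extend)) (tail {D} a)) (head {D} a)
        ≡⟨ cong (λ r → lookup r (head {D} a)) (lookup∘tabulate (tabulate ∘ extend) (tail {D} a)) ⟩
      lookup (tabulate (extend (tail {D} a))) (head {D} a)
        ≡⟨ lookup∘tabulate (extend (tail {D} a)) (head {D} a) ⟩
      extend (tail {D} a) (head {D} a)
        ≡⟨ extend-arc a ⟩
      f a ∎
      where open ≡-Reasoning

  HasStrongCoverPartition? : Arc D → ∀ k → Dec (HasStrongCoverPartition D k)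
  HasStrongCoverPartition? a₀ k =
    ∃?-by-decoding (Vec-searchable (Vec-searchable Fin-searchable)) arcTable
      (λ f → arcTable-surjective (f a₀) f) IsStrongCoverPartition-≗ IsStrongCoverPartition?

  module _ {E : Arc D → Set} where

    lift-walk : ∀ {x y w} → E x → E y → Star (SubArc D E) (head {D} x) w → tail {D} y ≡ w →
                Star (InducedAdj (L D) E) x y
    lift-walk Ex Ey ε                  t≡w = (Ex , Ey , sym t≡w) ◅ ε
    lift-walk Ex Ey ((_ , Ex′) ◅ walk) t≡w = (Ex , Ex′ , refl) ◅ lift-walk Ex′ Ey walk t≡w

    project-walk : ∀ {x y} → Star (InducedAdj (L D) E) x y →
                   Star (SubArc D E) (tail {D} x) (tail {D} y)
    project-walk ε = ε
    project-walk {x} ((Ex , _ , h≡t) ◅ walk) =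
      (proj₂ x , Ex) ◅ subst (λ t → Star (SubArc D E) t _) (sym h≡t) (project-walk walk)

module _ {D : Digraph} (3≤n : 3 ≤ n D) where

  vertex : Fin (n D)
  vertex = fromℕ< (≤-trans (s≤s z≤n) 3≤n)

  StrongCover⇒StrongInDominating : ∀ {E} → StrongCover D E → StrongInDominating (L D) E
  StrongCover⇒StrongInDominating {E} (_ , _ , walks) =
    (λ x _ → leaving (head {D} x)) , λ x y Ex Ey → lift-walk D Ex Ey (walks _ _) refl
    where
    leaving : ∀ v → ∃ λ a → v ≡ tail {D} a × E a
    leaving v with ∃≢₂ 3≤n v v
    ... | z , z≢v , _ with Star-first (z≢v ∘ sym) (walks v z)
    ... | w , p , Ea = ((v , w) , p) , refl , Ea

  module _ (strong : Strong (toGraph D)) where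

    in-arc : ∀ v → ∃ λ a → head {D} a ≡ v
    in-arc v with ∃≢₂ 3≤n v v
    ... | z , z≢v , _ = let (w , p) = Star-last z≢v (strong z v) in ((w , v) , p) , refl

    out-arc : ∀ v → ∃ λ a → tail {D} a ≡ v
    out-arc v with ∃≢₂ 3≤n v v
    ... | z , z≢v , _ = let (w , p) = Star-first (z≢v ∘ sym) (strong v z) in ((v , w) , p) , refl

    StrongInDominating⇒StrongCover : ∀ {E} → U.Decidable E →
                                     StrongInDominating (L D) E → StrongCover D E
    StrongInDominating⇒StrongCover {E} E? (dominating , induced) =
      (let (a , Ea , _) = ends vertex in a , Ea) , ends , walks
      where
      ends : ∀ v → EndVertex D E v
      ends v with in-arc v
      ... | a , refl with E? a
      ... | yes Ea  = a , Ea , inj₂ refl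
      ... | no  ¬Ea = let (f , h≡t , Ef) = dominating a ¬Ea in f , Ef , inj₁ (sym h≡t)

      -- An arc of E at a vertex off both ends of a.
      E-arc-≢ : ∀ a → ∃ λ b → E b × b ≢ a
      E-arc-≢ a with ∃≢₂ 3≤n (tail {D} a) (head {D} a)
      ... | z , z≢t , z≢h with ends z
      ... | b , Eb , inj₁ t≡z = b , Eb , λ b≡a → z≢t (trans (sym t≡z) (cong (tail {D}) b≡a))
      ... | b , Eb , inj₂ h≡z = b , Eb , λ b≡a → z≢h (trans (sym h≡z) (cong (head {D}) b≡a))

      leaving-head : ∀ {a} → E a → ∃ λ g → E g × tail {D} g ≡ head {D} a
      leaving-head {a} Ea with E-arc-≢ a
      ... | b , Eb , b≢a with Star-first (b≢a ∘ sym) (induced a b Ea Eb)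
      ... | g , _ , Eg , h≡t = g , Eg , sym h≡t

      leaving : ∀ v → ∃ λ f → E f × tail {D} f ≡ v
      leaving v with ends v
      ... | b , Eb , inj₁ t≡v = b , Eb , t≡v
      ... | b , Eb , inj₂ h≡v = let (g , Eg , t≡h) = leaving-head Eb in g , Eg , trans t≡h h≡v

      walks : ∀ u v → Star (SubArc D E) u v
      walks u v with leaving u | ends v
      ... | x , Ex , refl | y , Ey , inj₁ refl = project-walk D (induced x y Ex Ey)
      ... | x , Ex , refl | y , Ey , inj₂ refl =
        project-walk D (induced x y Ex Ey) ◅◅ (proj₂ y , Ey) ◅ ε

    partition⇔ : ∀ k → HasStrongCoverPartition D k ⇔ HasStrongInDomPartition (L D) k
    partition⇔ k = mk⇔
      (λ (c , part , covers) → c , part , λ i → StrongCover⇒StrongInDominating (covers i))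
      (λ (c , part , dominating) →
         c , part , λ i → StrongInDominating⇒StrongCover (λ a → c a ≟ i) (dominating i))

    arcs-StrongCoverPartition : HasStrongCoverPartition D 1
    arcs-StrongCoverPartition =
      (λ _ → zero) , (λ { zero → a₀ , refl }) , λ { zero → everything }
      where
      a₀ : Arc D
      a₀ = proj₁ (out-arc vertex)
      everything : StrongCover D (λ _ → zero ≡ zero)
      everything =
        (a₀ , refl) ,
        (λ v → let (a , t≡v) = out-arc v in a , refl , inj₁ t≡v) ,
        (λ u v → Star.map (λ p → p , refl) (strong u v))

    Λ-exists : ∃ (ΛIs D)
    Λ-exists =
      bounded⇒∃IsMax (HasStrongCoverPartition? D (proj₁ (out-arc vertex)))
        (λ (_ , part , _) → partition-size-≤ (arc-code D) (arc-code-injective D) part)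
        arcs-StrongCoverPartition

theorem9 : (D : Digraph) → Strong (toGraph D) → 3 ≤ n D →
    ∃[ m ] (dsIs (L D) m × ΛIs D m)
theorem9 D strong 3≤n =
  let (m , Λ≡m) = Λ-exists {D} 3≤n strong
  in  m , IsMax-⇔ (partition⇔ {D} 3≤n strong) Λ≡m , Λ≡m
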